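{- If $n$ is a primitive nondeficient number, then the largest prime factor of $n$ is at most $\sqrt{2n}$.
   Context: $\sigma(n)$ is the sum of divisors of $n$. A positive integer $n$ is nondeficient if $\sigma(n)/n\ge2$ and deficient if $\sigma(n)/n<2$; $n$ is a primitive nondeficient number if it is nondeficient and all its proper divisors are deficient. -}

module Defs where

open import Data.Nat using (ℕ; suc; _*_; _<_; _≥_)
open import Data.Nat.Divisibility using (_∣_; _∣?_)
open import Data.List using (List; applyUpTo; filter)
open import Data.Nat.ListAction using (sum)
open import Data.Product using (_×_)

divisors : ℕ → List ℕ
divisors n = filter (_∣? n) (applyUpTo suc n)

σ : ℕ → ℕ
σ n = sum (divisors n)

-- σ(n)/n ≥ 2, i.e. σ(n) ≥ 2n (for n > 0)
Nondeficient : ℕ → Set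
Nondeficient n = σ n ≥ 2 * n

-- σ(n)/n < 2, i.e. σ(n) < 2n (for n > 0)
Deficient : ℕ → Set
Deficient n = σ n < 2 * n

PrimitiveNondeficient : ℕ → Set
PrimitiveNondeficient n =
  Nondeficient n × (∀ d → d ∣ n → d < n → 0 < d → Deficient d)

-- Write n = m p. A divisor of p m is either a divisor of m or p times one, so
-- σ(p m) ≤ (1 + p) σ(m). Since m is a proper divisor it is deficient, σ(m) ≤ 2m − 1,
-- and nondeficiency of n gives 2pm ≤ (1 + p)(2m − 1), i.e. p < 2m; hence p² < 2pm = 2n.
module Submission where

open import Defs
open import Data.Nat
  using (ℕ; suc; _+_; _*_; _≤_; _<_; z≤n; s≤s; NonZero; >-nonZero; >-nonZero⁻¹; nonTrivial⇒n>1)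
open import Data.Nat.Properties
open import Data.Nat.Divisibility using (_∣_; divides; _∣?_; ∣⇒≤; m∣m*n; *-cancelˡ-∣)
open import Data.Nat.Primality using (Prime; prime⇒irreducible; prime⇒nonZero; prime⇒nonTrivial)
open import Data.Nat.Coprimality using (Coprime; coprime-divisor)
open import Data.Nat.ListAction using (sum)
open import Data.Nat.ListAction.Properties using (sum-++)
open import Data.Nat.Tactic.RingSolver using (solve-∀)
open import Algebra.Properties.CommutativeSemigroup +-commutativeSemigroup
  using () renaming (x∙yz≈y∙xz to m+[n+o]≡n+[m+o])
open import Algebra.Properties.CommutativeSemigroup *-commutativeSemigroup
  using () renaming (x∙yz≈y∙xz to m*[n*o]≡n*[m*o])
open import Data.List using ([]; _∷_; _++_; map; applyUpTo)
open import Data.List.Membership.Propositional using (_∈_; _─_)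
open import Data.List.Membership.Propositional.Properties
  using (∈-filter⁺; ∈-filter⁻; ∈-applyUpTo⁺; ∈-applyUpTo⁻; ∈-++⁺ˡ; ∈-++⁺ʳ; ∈-map⁺)
open import Data.List.Relation.Binary.Subset.Propositional using (_⊆_)
open import Data.List.Relation.Unary.Any using (here; there)
open import Data.List.Relation.Unary.All as All using ()
open import Data.List.Relation.Unary.AllPairs using (_∷_)
open import Data.List.Relation.Unary.Unique.Propositional using (Unique)
open import Data.List.Relation.Unary.Unique.Propositional.Properties using (filter⁺; applyUpTo⁺₁)
open import Data.Product using (_×_; _,_; ∃)
open import Data.Sum using (_⊎_; inj₁; inj₂)
open import Data.Empty using (⊥-elim)
open import Relation.Nullary using (¬_; yes; no)
open import Function using (_∘_)
open import Relation.Binary.PropositionalEquality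

sum-─ : ∀ {x} xs (x∈xs : x ∈ xs) → sum xs ≡ x + sum (xs ─ x∈xs)
sum-─ (_ ∷ xs) (here refl) = refl
sum-─ {x} (y ∷ xs) (there x∈xs) = begin
  y + sum xs                 ≡⟨ cong (y +_) (sum-─ xs x∈xs) ⟩
  y + (x + sum (xs ─ x∈xs))  ≡⟨ m+[n+o]≡n+[m+o] y x _ ⟩
  x + (y + sum (xs ─ x∈xs))  ∎
  where open ≡-Reasoning

∈-─ : ∀ {a} {A : Set a} {x y : A} xs (x∈xs : x ∈ xs) → y ∈ xs → y ≢ x → y ∈ xs ─ x∈xs
∈-─ (_ ∷ _)  (here refl)  (here refl)  y≢x = ⊥-elim (y≢x refl)
∈-─ (_ ∷ _)  (here refl)  (there y∈xs) _   = y∈xs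
∈-─ (_ ∷ _)  (there _)    (here refl)  _   = here refl
∈-─ (_ ∷ xs) (there x∈xs) (there y∈xs) y≢x = there (∈-─ xs x∈xs y∈xs y≢x)

sum-mono-⊆ : ∀ {xs} ys → Unique xs → xs ⊆ ys → sum xs ≤ sum ys
sum-mono-⊆ {[]}     ys _             _     = z≤n
sum-mono-⊆ {x ∷ xs} ys (x∉xs ∷ uniq) xs⊆ys = begin
  x + sum xs           ≤⟨ +-monoʳ-≤ x (sum-mono-⊆ (ys ─ x∈ys) uniq xs⊆ys─x) ⟩
  x + sum (ys ─ x∈ys)  ≡⟨ sum-─ ys x∈ys ⟨
  sum ys               ∎
  where
  open ≤-Reasoning
  x∈ys : x ∈ ys
  x∈ys = xs⊆ys (here refl)
  xs⊆ys─x : xs ⊆ ys ─ x∈ys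
  xs⊆ys─x y∈xs = ∈-─ ys x∈ys (xs⊆ys (there y∈xs)) (λ y≡x → All.lookup x∉xs y∈xs (sym y≡x))

sum-map-* : ∀ k xs → sum (map (k *_) xs) ≡ k * sum xs
sum-map-* k []       = sym (*-zeroʳ k)
sum-map-* k (x ∷ xs) = begin
  k * x + sum (map (k *_) xs)  ≡⟨ cong (k * x +_) (sum-map-* k xs) ⟩
  k * x + k * sum xs           ≡⟨ *-distribˡ-+ k x (sum xs) ⟨
  k * (x + sum xs)             ∎
  where open ≡-Reasoning

divisors-unique : ∀ n → Unique (divisors n)
divisors-unique n = filter⁺ (_∣? n) (applyUpTo⁺₁ suc n (λ i<j _ → <⇒≢ i<j ∘ suc-injective))

∈-divisors⁺ : ∀ {d n} .{{_ : NonZero n}} → 0 < d → d ∣ n → d ∈ divisors n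
∈-divisors⁺ {suc d} {n} _ d∣n = ∈-filter⁺ (_∣? n) (∈-applyUpTo⁺ suc (∣⇒≤ d∣n)) d∣n

∈-divisors⁻ : ∀ {d n} → d ∈ divisors n → 0 < d × d ∣ n
∈-divisors⁻ {n = n} d∈divs with ∈-filter⁻ (_∣? n) {xs = applyUpTo suc n} d∈divs
... | d∈range , d∣n with ∈-applyUpTo⁻ suc d∈range
... | _ , _ , refl = s≤s z≤n , d∣n

prime∤⇒coprime : ∀ {p d} → Prime p → ¬ p ∣ d → Coprime d p
prime∤⇒coprime pp p∤d (c∣d , c∣p) with prime⇒irreducible pp c∣p
... | inj₁ c≡1 = c≡1
... | inj₂ refl = ⊥-elim (p∤d c∣d)

prime-divisor-split : ∀ {p m d} → Prime p → d ∣ p * m → d ∣ m ⊎ ∃ λ e → e ∣ m × p * e ≡ d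
prime-divisor-split {p} {m} {d} pp d∣pm with p ∣? d
... | no  p∤d = inj₁ (coprime-divisor (prime∤⇒coprime pp p∤d) d∣pm)
... | yes (divides e refl) = inj₂ (e , e∣m , *-comm p e)
  where
  instance
    p≢0 : NonZero p
    p≢0 = prime⇒nonZero pp
  e∣m : e ∣ m
  e∣m = *-cancelˡ-∣ p (subst (_∣ p * m) (*-comm e p) d∣pm)

divisors-*-prime-⊆ : ∀ {p m} → Prime p → .{{_ : NonZero m}} →
  divisors (p * m) ⊆ divisors m ++ map (p *_) (divisors m)
divisors-*-prime-⊆ {p} {m} pp d∈divs with ∈-divisors⁻ d∈divs
... | 0<d , d∣pm with prime-divisor-split pp d∣pm
...   | inj₁ d∣m = ∈-++⁺ˡ (∈-divisors⁺ 0<d d∣m)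
...   | inj₂ (e , e∣m , refl) = ∈-++⁺ʳ (divisors m) (∈-map⁺ (p *_) (∈-divisors⁺ 0<e e∣m))
  where
  0<e : 0 < e
  0<e = >-nonZero⁻¹ e {{m*n≢0⇒n≢0 p {{>-nonZero 0<d}}}}

σ[p*m]≤[1+p]*σ[m] : ∀ {p m} → Prime p → .{{_ : NonZero m}} → σ (p * m) ≤ (1 + p) * σ m
σ[p*m]≤[1+p]*σ[m] {p} {m} pp = begin
  σ (p * m)
    ≤⟨ sum-mono-⊆ _ (divisors-unique (p * m)) (divisors-*-prime-⊆ pp) ⟩
  sum (divisors m ++ map (p *_) (divisors m))  ≡⟨ sum-++ (divisors m) _ ⟩
  σ m + sum (map (p *_) (divisors m))          ≡⟨ cong (σ m +_) (sum-map-* p (divisors m)) ⟩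
  σ m + p * σ m                                ∎
  where open ≤-Reasoning

deficient-cofactor⇒p<2m : ∀ {p m s} → 2 * (p * m) ≤ (1 + p) * s → s < 2 * m → p < 2 * m
deficient-cofactor⇒p<2m {p} {m} {s} 2pm≤[1+p]s s<2m =
  +-cancelˡ-≤ (2 * (p * m)) (1 + p) (2 * m) (begin
    2 * (p * m) + (1 + p)  ≤⟨ +-monoˡ-≤ (1 + p) 2pm≤[1+p]s ⟩
    (1 + p) * s + (1 + p)  ≡⟨ add-factor p s ⟩
    (1 + p) * suc s        ≤⟨ *-monoʳ-≤ (1 + p) s<2m ⟩
    (1 + p) * (2 * m)      ≡⟨ expand p m ⟩
    2 * (p * m) + 2 * m    ∎)
  where
  open ≤-Reasoning
  add-factor : ∀ p s → (1 + p) * s + (1 + p) ≡ (1 + p) * suc s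
  add-factor = solve-∀
  expand : ∀ p m → (1 + p) * (2 * m) ≡ 2 * (p * m) + 2 * m
  expand = solve-∀

lemma4p2 : ∀ (n : ℕ) → 0 < n → PrimitiveNondeficient n →
    ∀ (p : ℕ) → Prime p → p ∣ n → p * p ≤ 2 * n
lemma4p2 _ 0<n (nondeficient , properDivisorsDeficient) p pp (divides m refl) = begin
  p * p        ≤⟨ *-monoʳ-≤ p (<⇒≤ p<2m) ⟩
  p * (2 * m)  ≡⟨ m*[n*o]≡n*[m*o] p 2 m ⟩
  2 * (p * m)  ≡⟨ cong (2 *_) (*-comm p m) ⟩
  2 * (m * p)  ∎
  where
  open ≤-Reasoning
  instance
    m≢0 : NonZero m
    m≢0 = m*n≢0⇒m≢0 m {{>-nonZero 0<n}}
  m<n : m < m * p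
  m<n = m<m*n m p (nonTrivial⇒n>1 p {{prime⇒nonTrivial pp}})
  σ[m]<2m : σ m < 2 * m
  σ[m]<2m = properDivisorsDeficient m (m∣m*n p) m<n (>-nonZero⁻¹ m)
  2pm≤σ[pm] : 2 * (p * m) ≤ σ (p * m)
  2pm≤σ[pm] = subst (λ k → 2 * k ≤ σ k) (*-comm m p) nondeficient
  p<2m : p < 2 * m
  p<2m = deficient-cofactor⇒p<2m (≤-trans 2pm≤σ[pm] (σ[p*m]≤[1+p]*σ[m] pp)) σ[m]<2m
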